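{- Let $q=c/d>1$ be a rational number with $c,d$ relatively prime positive integers. For $1\leq i\leq d$ let $a_i\in\{1,\ldots,c\}$ with $a_i\equiv d^{ -1}(c-d-1+i)\pmod c$, and for $0\leq m\leq c-d-1$ let $b_m\in\{1,\ldots,c\}$ with $b_m\equiv d^{ -1}m-1\pmod c$ (where $d^{ -1}$ is the inverse of $d$ modulo $c$). Then $$A(x)=\frac{\sum_{i=1}^d x^{1+a_i+\left\lfloor\frac{a_i}{q}\right\rfloor}}{1-x^{c+d}},\quad B(x)=\frac{\sum_{i=1}^d x^{2+a_i+\left\lfloor\frac{a_i}{q}\right\rfloor}}{1-x^{c+d}},\quad C(x)=\frac{\sum_{i=2}^{c+1}x^{i+\left\lfloor\frac{i}{q}\right\rfloor}}{1-x^{c+d}},$$ and, for $1\leq i\leq\lceil q\rceil-1$, $$D_i(x)=\frac{\sum_{m=0}^{c-1-di}x^{1+b_m+\left\lfloor\frac{b_m+1}{q}\right\rfloor}}{1-x^{c+d}}.$$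
   Context: A binary word is $q$-decreasing if every maximal factor $0^a1^b$ satisfies $a=0$ or $qa>b$. Let $\mathcal{F}$ be the set of words $0^a1^b$ with $a,b\geq1$ and $1+\lfloor b/q\rfloor\leq a\leq 1+\lfloor (b+1)/q\rfloor$. Define subsets of $\mathcal{F}$: $\mathtt{C}$ = the words $0^a1^b\in\mathcal{F}$ such that $0^a1^{b+1}$ is $q$-decreasing; $\mathtt{A}=\mathcal{F}\setminus\mathtt{C}$; $\mathtt{B}$ = the words $0^a1^b\in\mathcal{F}$ with $a\geq2$ such that $0^{a-1}1^b$ is $q$-decreasing; for $1\leq i\leq\lceil q\rceil-1$, $\mathtt{D}_i$ = the words $0^a1^b\in\mathcal{F}$ such that $0^a1^{b+i+1}$ is $q$-decreasing. $A(x),B(x),C(x),D_i(x)$ are the generating functions of $\mathtt{A},\mathtt{B},\mathtt{C},\mathtt{D}_i$ respectively, where $0^a1^b$ has weight $x^{a+b}$. -}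

module Defs where

open import Data.Bool using (Bool; true; false; if_then_else_)
open import Data.Nat using (ℕ; zero; suc; _+_; _*_; _∸_; _≤_; _<_; _≤?_; _<?_; _≟_; NonZero)
open import Data.Nat.DivMod using (_/_)
open import Data.Nat.Divisibility using (_∣?_)
open import Data.List using (List; []; _∷_; _++_; replicate; length; filter; upTo; map)
open import Data.Nat.ListAction using (sum)
open import Data.List.Relation.Unary.All using (All; all?)
open import Data.Product using (_×_; _,_)
open import Data.Sum using (_⊎_)
open import Relation.Binary.PropositionalEquality using (_≡_)
open import Relation.Nullary using (Dec; ¬_; ¬?)
open import Relation.Nullary.Decidable using (_×-dec_; _⊎-dec_; ⌊_⌋)

-- Binary words: false = letter 0, true = letter 1.
Word : Set
Word = List Bool

word : ℕ → ℕ → Word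
word a b = replicate a false ++ replicate b true

-- Maximal factors 0^a1^b of a word (as pairs (a,b)), read left to right.
-- State (a,b): current factor 0^a 1^b being read.
blocksGo : ℕ → ℕ → Word → List (ℕ × ℕ)
blocksGo zero zero [] = []
blocksGo a b [] = (a , b) ∷ []
blocksGo a zero (false ∷ w) = blocksGo (suc a) zero w
blocksGo a (suc b) (false ∷ w) = (a , suc b) ∷ blocksGo 1 zero w
blocksGo a b (true ∷ w) = blocksGo a (suc b) w

blocks : Word → List (ℕ × ℕ)
blocks = blocksGo 0 0

-- q = c/d : the factor 0^a1^b satisfies a = 0 or q a > b (i.e. d b < c a)
okBlock : ℕ → ℕ → ℕ × ℕ → Set
okBlock c d (a , b) = a ≡ 0 ⊎ d * b < c * a

okBlock? : (c d : ℕ) → (p : ℕ × ℕ) → Dec (okBlock c d p)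
okBlock? c d (a , b) = (a ≟ 0) ⊎-dec (d * b <? c * a)

qDecreasing : ℕ → ℕ → Word → Set
qDecreasing c d w = All (okBlock c d) (blocks w)

qDecreasing? : (c d : ℕ) → (w : Word) → Dec (qDecreasing c d w)
qDecreasing? c d w = all? (okBlock? c d) (blocks w)

-- ⌊ n / q ⌋ = ⌊ n d / c ⌋
floorDivQ : (c d : ℕ) → {{NonZero c}} → ℕ → ℕ
floorDivQ c d n = (n * d) / c

ceilDiv : (c d : ℕ) → {{NonZero d}} → ℕ
ceilDiv c d = (c + d ∸ 1) / d

inF : (c d : ℕ) → {{NonZero c}} → ℕ → ℕ → Set
inF c d a b = (1 ≤ a × 1 ≤ b) × (1 + floorDivQ c d b ≤ a × a ≤ 1 + floorDivQ c d (suc b))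

inF? : (c d : ℕ) → {{_ : NonZero c}} → (a b : ℕ) → Dec (inF c d a b)
inF? c d a b = ((1 ≤? a) ×-dec (1 ≤? b)) ×-dec ((1 + floorDivQ c d b ≤? a) ×-dec (a ≤? 1 + floorDivQ c d (suc b)))

inC : (c d : ℕ) → {{NonZero c}} → ℕ → ℕ → Set
inC c d a b = inF c d a b × qDecreasing c d (word a (suc b))

inA : (c d : ℕ) → {{NonZero c}} → ℕ → ℕ → Set
inA c d a b = inF c d a b × ¬ qDecreasing c d (word a (suc b))

inB : (c d : ℕ) → {{NonZero c}} → ℕ → ℕ → Set
inB c d a b = inF c d a b × (2 ≤ a × qDecreasing c d (word (a ∸ 1) b))

inD : (c d : ℕ) → {{NonZero c}} → ℕ → ℕ → ℕ → Set
inD c d i a b = inF c d a b × qDecreasing c d (word a (b + i + 1))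

inC? : (c d : ℕ) → {{_ : NonZero c}} → (a b : ℕ) → Dec (inC c d a b)
inC? c d a b = inF? c d a b ×-dec qDecreasing? c d (word a (suc b))

inA? : (c d : ℕ) → {{_ : NonZero c}} → (a b : ℕ) → Dec (inA c d a b)
inA? c d a b = inF? c d a b ×-dec ¬? (qDecreasing? c d (word a (suc b)))

inB? : (c d : ℕ) → {{_ : NonZero c}} → (a b : ℕ) → Dec (inB c d a b)
inB? c d a b = inF? c d a b ×-dec ((2 ≤? a) ×-dec qDecreasing? c d (word (a ∸ 1) b))

inD? : (c d i : ℕ) → {{_ : NonZero c}} → (a b : ℕ) → Dec (inD c d i a b)
inD? c d i a b = inF? c d a b ×-dec qDecreasing? c d (word a (b + i + 1))

-- Formal power series with ℕ coefficients: coefficient functions.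
Series : Set
Series = ℕ → ℕ

-- generating function of a (decidable) set S of words 0^a1^b, weight x^(a+b):
-- coefficient of x^n = number of a ∈ {0..n} with 0^a1^(n-a) ∈ S
genFun : {S : ℕ → ℕ → Set} → ((a b : ℕ) → Dec (S a b)) → Series
genFun S? n = length (filter (λ a → S? a (n ∸ a)) (upTo (suc n)))

-- polynomial Σ_{e ∈ es} x^e
poly : List ℕ → Series
poly es n = length (filter (λ e → e ≟ n) es)

-- 1 / (1 - x^p) = Σ_k x^(k p)
geom : ℕ → Series
geom p n = if ⌊ p ∣? n ⌋ then 1 else 0

_⊛_ : Series → Series → Series
(f ⊛ g) n = sum (map (λ k → f k * g (n ∸ k)) (upTo (suc n)))

-- Write F b = ⌊b/q⌋.  The q-decreasing condition on 0^a 1^k reads F k < a, and F (b + 1) is F b or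
-- F b + 1.  Hence each of A, B, C, D contains, for every b ≥ 1, at most one word 0^a 1^b: a is
-- 1 + F b (A), 2 + F b (B) or 1 + F (b + 1) (C, D), and the word exists iff (b + 1) d mod c is
-- < d (F jumps at b: A, B), arbitrary (C), or < c − d i (F constant on [b + 1, b + 1 + i]: D).
-- Since F (b + c) = F b + d, shifting b by c adds c + d to the weight a + b and keeps the condition,
-- so each generating function is Σ x^(weight x) / (1 − x^(c+d)) over the x ∈ {1, …, c} meeting
-- the condition.  Those x are exactly the a_i resp. b_m: multiplying by d⁻¹ modulo c shows that
-- (x + 1) d mod c runs through i − 1 resp. m.

module Submission where

open import Defs
open import Level using (0ℓ)
open import Data.Bool using (true; false)
open import Data.Nat using (ℕ; zero; suc; pred; _+_; _*_; _∸_; _≤_; _<_; _≟_; _≤?_; _<?_; NonZero; >-nonZero⁻¹; z≤n; s≤s; z<s)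
open import Data.Nat.Properties
open import Data.Nat.Coprimality using (Coprime)
open import Data.Nat.Divisibility using (_∣_; _∣?_; divides)
open import Data.Nat.DivMod using (_%_; _/_; m%n<n; m≡m%n+[m/n]*n; [m+kn]%n≡m%n; m<n⇒m%n≡m; %-congˡ; /-congˡ;
  %-distribˡ-+; %-distribˡ-*; m%n%n≡m%n; /-monoˡ-≤; +-distrib-/-∣ʳ; m*n/n≡m; m<n*o⇒m/o<n; m<n⇒m/n≡0; m/n≡0⇒m<n; m/n*n≤m; m/n≡1+[m∸n]/n; m≤n⇒[n∸m]%m≡n%m)
open import Data.Nat.Tactic.RingSolver using (solve-∀)
open import Data.Nat.ListAction using (sum)
open import Data.List using (List; []; _∷_; [_]; _++_; replicate; map; filter; length; upTo)
open import Data.List.Properties using (filter-++; length-++; filter-accept; filter-reject; filter-none; map-cong; map-upTo; map-∘)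
open import Data.List.Membership.Propositional using (_∈_; find; lose)
open import Data.List.Membership.Propositional.Properties using (∈-upTo⁺; ∈-upTo⁻; ∈-map⁺; ∈-map⁻)
open import Data.List.Relation.Unary.All as All using (All; []; _∷_)
open import Data.List.Relation.Unary.Any using (Any; here; there; any?)
open import Data.List.Relation.Unary.AllPairs using ([]; _∷_)
open import Data.List.Relation.Unary.Unique.Propositional using (Unique)
open import Data.List.Relation.Unary.Unique.Propositional.Properties using (upTo⁺; map⁺; applyUpTo⁺₁)
open import Data.Sum using (_⊎_; inj₁; inj₂)
open import Data.Unit using (⊤; tt)
open import Data.Product using (_×_; _,_; proj₁; proj₂; ∃-syntax)
open import Relation.Nullary using (Dec; yes; no; ¬_; contradiction)
open import Relation.Nullary.Decidable using (_×-dec_; map′)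
open import Relation.Unary using (Pred; Decidable)
open import Relation.Binary.Definitions using (tri<; tri≈; tri>)
open import Function using (id; _∘_; _⇔_; mk⇔; Equivalence)
open import Relation.Binary.PropositionalEquality hiding ([_])

module _ {A : Set} {P : Pred A 0ℓ} (P? : Decidable P) where

  length-filter-∷ : ∀ x xs → length (filter P? (x ∷ xs)) ≡ length (filter P? [ x ]) + length (filter P? xs)
  length-filter-∷ x xs = trans (cong length (filter-++ P? [ x ] xs)) (length-++ (filter P? [ x ]))

  length-filter-none : ∀ {xs} → (∀ {x} → x ∈ xs → ¬ P x) → length (filter P? xs) ≡ 0
  length-filter-none ¬P = cong length (filter-none P? (All.tabulate ¬P))

  length-filter-unique : ∀ {xs x} → Unique xs → x ∈ xs → P x →
    (∀ {y} → y ∈ xs → P y → y ≡ x) → length (filter P? xs) ≡ 1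
  length-filter-unique {y ∷ ys} (y∉ys ∷ uys) x∈xs Px only with P? y
  ... | yes Py = cong suc (length-filter-none λ z∈ys Pz →
                  All.lookup y∉ys z∈ys (trans (only (here refl) Py) (sym (only (there z∈ys) Pz))))
  ... | no ¬Py with x∈xs
  ...   | here refl = contradiction Px ¬Py
  ...   | there x∈ys = length-filter-unique uys x∈ys Px (λ z∈ys → only (there z∈ys))

map-fuse : {A B C : Set} {h : B → C} {f : A → B} {k : A → C} → (∀ x → h (f x) ≡ k x) →
  ∀ xs → map h (map f xs) ≡ map k xs
map-fuse hf≗k xs = trans (sym (map-∘ xs)) (map-cong hf≗k xs)

sum-map-+ : {A : Set} (f g : A → ℕ) (xs : List A) →
  sum (map (λ x → f x + g x) xs) ≡ sum (map f xs) + sum (map g xs)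
sum-map-+ f g [] = refl
sum-map-+ f g (x ∷ xs) = trans (cong (f x + g x +_) (sum-map-+ f g xs)) (+-interchange (f x) (g x) _ _)
  where open import Algebra.Properties.CommutativeSemigroup +-commutativeSemigroup
          using () renaming (interchange to +-interchange)

sum-map-0 : {A : Set} (xs : List A) → sum (map (λ _ → 0) xs) ≡ 0
sum-map-0 [] = refl
sum-map-0 (_ ∷ xs) = sum-map-0 xs

-- Coefficients of a polynomial divided by 1 - x^p

geom-∣ : ∀ {p m} → p ∣ m → geom p m ≡ 1
geom-∣ {p} {m} p∣m with p ∣? m
... | yes _ = refl
... | no p∤m = contradiction p∣m p∤m

geom-∤ : ∀ {p m} → ¬ p ∣ m → geom p m ≡ 0
geom-∤ {p} {m} p∤m with p ∣? m
... | yes p∣m = contradiction p∣m p∤m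
... | no _ = refl

poly-∷ : ∀ e es k → poly (e ∷ es) k ≡ poly [ e ] k + poly es k
poly-∷ e es k = length-filter-∷ (_≟ k) e es

poly-[-]-≢ : ∀ {e k} → e ≢ k → poly [ e ] k ≡ 0
poly-[-]-≢ {k = k} e≢k = cong length (filter-reject (_≟ k) e≢k)

poly-[-]-swap : ∀ e x (h : ℕ → ℕ) → poly [ e ] x * h x ≡ poly [ x ] e * h e
poly-[-]-swap e x h with e ≟ x
... | yes refl = refl
... | no e≢x = trans (cong (_* h x) (poly-[-]-≢ e≢x)) (sym (cong (_* h e) (poly-[-]-≢ (e≢x ∘ sym))))

sum-monomial : ∀ e (h : ℕ → ℕ) xs → sum (map (λ k → poly [ e ] k * h k) xs) ≡ poly xs e * h e
sum-monomial e h [] = refl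
sum-monomial e h (x ∷ xs) = begin
  poly [ e ] x * h x + sum (map (λ k → poly [ e ] k * h k) xs) ≡⟨ cong₂ _+_ (poly-[-]-swap e x h) (sum-monomial e h xs) ⟩
  poly [ x ] e * h e + poly xs e * h e                          ≡⟨ sym (*-distribʳ-+ (h e) (poly [ x ] e) _) ⟩
  (poly [ x ] e + poly xs e) * h e                              ≡⟨ cong (_* h e) (sym (poly-∷ x xs e)) ⟩
  poly (x ∷ xs) e * h e                                         ∎
  where open ≡-Reasoning

poly-upTo-≤ : ∀ {e n} → e ≤ n → poly (upTo (suc n)) e ≡ 1
poly-upTo-≤ e≤n = length-filter-unique (_≟ _) (upTo⁺ _) (∈-upTo⁺ (s≤s e≤n)) refl (λ _ y≡e → y≡e)

poly-upTo-> : ∀ {e n} → n < e → poly (upTo (suc n)) e ≡ 0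
poly-upTo-> n<e = length-filter-none (_≟ _) λ y∈ y≡e → <⇒≱ (∈-upTo⁻ y∈) (subst (_ ≤_) (sym y≡e) n<e)

-- x ^ n occurs in x ^ e / (1 - x ^ p)
OnProgression : ℕ → ℕ → ℕ → Set
OnProgression p n e = e ≤ n × p ∣ n ∸ e

onProgression? : ∀ p n → Decidable (OnProgression p n)
onProgression? p n e = (e ≤? n) ×-dec (p ∣? (n ∸ e))

monomial-⊛-geom : ∀ p e n → (poly [ e ] ⊛ geom p) n ≡ length (filter (onProgression? p n) [ e ])
monomial-⊛-geom p e n = trans (sum-monomial e (λ k → geom p (n ∸ k)) (upTo (suc n))) (count (onProgression? p n e))
  where
  count : Dec (OnProgression p n e) →
          poly (upTo (suc n)) e * geom p (n ∸ e) ≡ length (filter (onProgression? p n) [ e ])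
  count (yes on@(e≤n , p∣)) = begin
    poly (upTo (suc n)) e * geom p (n ∸ e) ≡⟨ cong₂ _*_ (poly-upTo-≤ e≤n) (geom-∣ p∣) ⟩
    1                                      ≡⟨ cong length (sym (filter-accept (onProgression? p n) on)) ⟩
    length (filter (onProgression? p n) [ e ]) ∎
    where open ≡-Reasoning
  count (no off) = trans (vanish (e ≤? n)) (cong length (sym (filter-reject (onProgression? p n) off)))
    where
    vanish : Dec (e ≤ n) → poly (upTo (suc n)) e * geom p (n ∸ e) ≡ 0
    vanish (yes e≤n) = trans (cong (poly (upTo (suc n)) e *_) (geom-∤ (off ∘ (e≤n ,_)))) (*-zeroʳ (poly (upTo (suc n)) e))
    vanish (no e≰n) = cong (_* geom p (n ∸ e)) (poly-upTo-> (≰⇒> e≰n))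

⊛-poly-∷ : ∀ e es h n → (poly (e ∷ es) ⊛ h) n ≡ (poly [ e ] ⊛ h) n + (poly es ⊛ h) n
⊛-poly-∷ e es h n = trans
  (cong sum (map-cong (λ k → trans (cong (_* h (n ∸ k)) (poly-∷ e es k)) (*-distribʳ-+ (h (n ∸ k)) (poly [ e ] k) (poly es k))) (upTo (suc n))))
  (sum-map-+ (λ k → poly [ e ] k * h (n ∸ k)) (λ k → poly es k * h (n ∸ k)) (upTo (suc n)))

poly-⊛-geom : ∀ p es n → (poly es ⊛ geom p) n ≡ length (filter (onProgression? p n) es)
poly-⊛-geom p [] n = sum-map-0 (upTo (suc n))
poly-⊛-geom p (e ∷ es) n = begin
  (poly (e ∷ es) ⊛ geom p) n                       ≡⟨ ⊛-poly-∷ e es (geom p) n ⟩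
  (poly [ e ] ⊛ geom p) n + (poly es ⊛ geom p) n   ≡⟨ cong₂ _+_ (monomial-⊛-geom p e n) (poly-⊛-geom p es n) ⟩
  length (filter (onProgression? p n) [ e ]) + length (filter (onProgression? p n) es) ≡⟨ sym (length-filter-∷ (onProgression? p n) e es) ⟩
  length (filter (onProgression? p n) (e ∷ es))    ∎
  where open ≡-Reasoning

-- Periodic families of words

InWindow : ℕ → ℕ → Set
InWindow c x = 1 ≤ x × x ≤ c

window-rep-unique : ∀ c .{{_ : NonZero c}} {x x′} j j′ → InWindow c x → InWindow c x′ →
  x + j * c ≡ x′ + j′ * c → x ≡ x′
window-rep-unique c {suc u} {suc u′} j j′ (_ , u<c) (_ , u′<c) eq = cong suc (begin
  u                 ≡⟨ sym (m<n⇒m%n≡m u<c) ⟩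
  u % c             ≡⟨ sym ([m+kn]%n≡m%n u j c) ⟩
  (u + j * c) % c   ≡⟨ cong ((_% c) ∘ pred) eq ⟩
  (u′ + j′ * c) % c ≡⟨ [m+kn]%n≡m%n u′ j′ c ⟩
  u′ % c            ≡⟨ m<n⇒m%n≡m u′<c ⟩
  u′                ∎)
  where open ≡-Reasoning

record EnumeratesWindow (c : ℕ) (Q : ℕ → Set) (L : List ℕ) : Set where
  field
    unique   : Unique L
    sound    : ∀ {x} → x ∈ L → InWindow c x × Q x
    complete : ∀ {x} → InWindow c x → Q x → x ∈ L

upTo-window : ∀ c → EnumeratesWindow c (λ _ → ⊤) (map suc (upTo c))
upTo-window c = record { unique = map⁺ suc-injective (upTo⁺ c) ; sound = sound ; complete = complete }
  where
  sound : ∀ {x} → x ∈ map suc (upTo c) → InWindow c x × ⊤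
  sound x∈ with j , j∈ , refl ← ∈-map⁻ suc x∈ = (s≤s z≤n , ∈-upTo⁻ j∈) , tt
  complete : ∀ {x} → InWindow c x → ⊤ → x ∈ map suc (upTo c)
  complete {suc u} (_ , u<c) _ = ∈-map⁺ suc (∈-upTo⁺ u<c)

module PeriodicFamily
  {S : ℕ → ℕ → Set} (S? : ∀ a b → Dec (S a b))
  (c e : ℕ) .{{_ : NonZero c}}
  (Q : ℕ → Set) (g : ℕ → ℕ)
  (S⇔ : ∀ a b → S a b ⇔ ((1 ≤ b × Q b) × a ≡ g b))
  (g-mono : ∀ {m n} → m ≤ n → g m ≤ g n)
  (g-periodic : ∀ x k → g (x + k * c) ≡ g x + k * e)
  (Q-periodic : ∀ x k → Q (x + k * c) ⇔ Q x)
  where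

  weight : ℕ → ℕ
  weight b = b + g b

  weight-injective : ∀ {b b′} → weight b ≡ weight b′ → b ≡ b′
  weight-injective {b} {b′} eq with <-cmp b b′
  ... | tri< b<b′ _ _ = contradiction eq (<⇒≢ (+-mono-<-≤ b<b′ (g-mono (<⇒≤ b<b′))))
  ... | tri≈ _ b≡b′ _ = b≡b′
  ... | tri> _ _ b>b′ = contradiction (sym eq) (<⇒≢ (+-mono-<-≤ b>b′ (g-mono (<⇒≤ b>b′))))

  weight-periodic : ∀ x k → weight (x + k * c) ≡ weight x + k * (c + e)
  weight-periodic x k = trans (cong (x + k * c +_) (g-periodic x k)) (arith x k c (g x) e)
    where
    arith : ∀ x k c y e → x + k * c + (y + k * e) ≡ x + y + k * (c + e)
    arith = solve-∀

  Hit : ℕ → Set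
  Hit n = ∃[ b ] (1 ≤ b × Q b) × weight b ≡ n

  module _ {n : ℕ} where

    hit-from-word : ∀ {a} → S a (n ∸ a) → a ≤ n → Hit n
    hit-from-word {a} s a≤n with Equivalence.to (S⇔ a (n ∸ a)) s
    ... | good , a≡g = n ∸ a , good , (begin
      n ∸ a + g (n ∸ a) ≡⟨ cong (n ∸ a +_) (sym a≡g) ⟩
      n ∸ a + a         ≡⟨ m∸n+n≡m a≤n ⟩
      n                 ∎)
      where open ≡-Reasoning

    word-from-hit : ((b , good , _) : Hit n) → S (g b) (n ∸ g b)
    word-from-hit (b , good , wb≡n) =
      subst (S (g b)) (sym (trans (cong (_∸ g b) (sym wb≡n)) (m+n∸n≡m b (g b))))
            (Equivalence.from (S⇔ (g b) b) (good , refl))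

    g≤n : ((b , _) : Hit n) → g b ≤ n
    g≤n (b , _ , wb≡n) = subst (g b ≤_) wb≡n (m≤n+m (g b) b)

    hit-unique : ((b , _) (b′ , _) : Hit n) → b ≡ b′
    hit-unique (_ , _ , wb≡n) (_ , _ , wb′≡n) = weight-injective (trans wb≡n (sym wb′≡n))

    hit? : Dec (Hit n)
    hit? = map′ fromAny (λ h → lose (∈-upTo⁺ (s≤s (g≤n h))) (word-from-hit h)) (any? (λ a → S? a (n ∸ a)) (upTo (suc n)))
      where
      fromAny : Any (λ a → S a (n ∸ a)) (upTo (suc n)) → Hit n
      fromAny any with _ , a∈ , s ← find any = hit-from-word s (≤-pred (∈-upTo⁻ a∈))

    genFun-hit : Hit n → genFun S? n ≡ 1
    genFun-hit h@(b , _) = length-filter-unique (λ a → S? a (n ∸ a)) (upTo⁺ (suc n)) (∈-upTo⁺ (s≤s (g≤n h))) (word-from-hit h) only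
      where
      only : ∀ {a} → a ∈ upTo (suc n) → S a (n ∸ a) → a ≡ g b
      only {a} a∈ s = trans (proj₂ (Equivalence.to (S⇔ a (n ∸ a)) s)) (cong g (hit-unique (hit-from-word s (≤-pred (∈-upTo⁻ a∈))) h))

    genFun-miss : ¬ Hit n → genFun S? n ≡ 0
    genFun-miss miss = length-filter-none (λ a → S? a (n ∸ a)) λ a∈ s → miss (hit-from-word s (≤-pred (∈-upTo⁻ a∈)))

    onProgression⇒ : ∀ {x} → OnProgression (c + e) n (weight x) → ∃[ k ] weight (x + k * c) ≡ n
    onProgression⇒ {x} (wx≤n , divides k n∸wx≡) = k , (begin
      weight (x + k * c)       ≡⟨ weight-periodic x k ⟩
      weight x + k * (c + e)   ≡⟨ cong (weight x +_) (sym n∸wx≡) ⟩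
      weight x + (n ∸ weight x) ≡⟨ m+[n∸m]≡n wx≤n ⟩
      n                        ∎)
      where open ≡-Reasoning

    ⇒onProgression : ∀ {x} k → weight (x + k * c) ≡ n → OnProgression (c + e) n (weight x)
    ⇒onProgression {x} k eq =
      subst (weight x ≤_) wx+kP≡n (m≤m+n (weight x) (k * (c + e))) ,
      divides k (trans (cong (_∸ weight x) (sym wx+kP≡n)) (m+n∸m≡n (weight x) (k * (c + e))))
      where
      wx+kP≡n : weight x + k * (c + e) ≡ n
      wx+kP≡n = trans (sym (weight-periodic x k)) eq

  module _ {L : List ℕ} (enum : EnumeratesWindow c Q L) {n : ℕ} where
    open EnumeratesWindow enum

    hit-from-residue : ∀ {x} k → x ∈ L → weight (x + k * c) ≡ n → Hit n
    hit-from-residue {x} k x∈L eq with (1≤x , _) , Qx ← sound x∈L =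
      x + k * c , (≤-trans 1≤x (m≤m+n x (k * c)) , Equivalence.from (Q-periodic x k) Qx) , eq

    series-hit : Hit n → length (filter (onProgression? (c + e) n) (map weight L)) ≡ 1
    series-hit h@(suc b′ , (_ , Qb) , wb≡n) = length-filter-unique (onProgression? (c + e) n)
      (map⁺ weight-injective unique) (∈-map⁺ weight x₀∈L) (⇒onProgression j₀ (trans (cong weight (sym b≡)) wb≡n)) only
      where
      x₀ = suc (b′ % c)
      j₀ = b′ / c
      b≡ : suc b′ ≡ x₀ + j₀ * c
      b≡ = cong suc (m≡m%n+[m/n]*n b′ c)
      x₀∈L : x₀ ∈ L
      x₀∈L = complete (s≤s z≤n , m%n<n b′ c) (Equivalence.to (Q-periodic x₀ j₀) (subst Q b≡ Qb))
      only : ∀ {y} → y ∈ map weight L → OnProgression (c + e) n y → y ≡ weight x₀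
      only y∈ on with x , x∈L , refl ← ∈-map⁻ weight y∈ with k , wxk≡n ← onProgression⇒ on =
        cong weight (window-rep-unique c k j₀ (proj₁ (sound x∈L)) (s≤s z≤n , m%n<n b′ c)
          (trans (hit-unique (hit-from-residue k x∈L wxk≡n) h) b≡))

    series-miss : ¬ Hit n → length (filter (onProgression? (c + e) n) (map weight L)) ≡ 0
    series-miss miss = length-filter-none (onProgression? (c + e) n) λ y∈ on →
      let x , x∈L , y≡wx = ∈-map⁻ weight y∈ ; k , wxk≡n = onProgression⇒ (subst (OnProgression (c + e) n) y≡wx on)
      in miss (hit-from-residue k x∈L wxk≡n)

  genFun≡poly⊛geom : ∀ {L} → EnumeratesWindow c Q L → ∀ n → genFun S? n ≡ (poly (map weight L) ⊛ geom (c + e)) n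
  genFun≡poly⊛geom {L} enum n = trans (count hit?) (sym (poly-⊛-geom (c + e) (map weight L) n))
    where
    count : Dec (Hit n) → genFun S? n ≡ length (filter (onProgression? (c + e) n) (map weight L))
    count (yes h) = trans (genFun-hit h) (sym (series-hit enum h))
    count (no miss) = trans (genFun-miss miss) (sym (series-miss enum miss))

blocksGo-ones : ∀ a b n → blocksGo (suc a) b (replicate n true) ≡ (suc a , b + n) ∷ []
blocksGo-ones a b zero = cong (λ t → (suc a , t) ∷ []) (sym (+-identityʳ b))
blocksGo-ones a zero (suc n) = blocksGo-ones a 1 n
blocksGo-ones a (suc b) (suc n) = trans (blocksGo-ones a (2 + b) n) (cong (λ t → (suc a , t) ∷ []) (sym (+-suc (suc b) n)))

blocksGo-zeros : ∀ a n w → blocksGo (suc a) zero (replicate n false ++ w) ≡ blocksGo (suc a + n) zero w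
blocksGo-zeros a zero w = cong (λ t → blocksGo t zero w) (sym (+-identityʳ (suc a)))
blocksGo-zeros a (suc n) w = trans (blocksGo-zeros (suc a) n w) (cong (λ t → blocksGo t zero w) (sym (+-suc (suc a) n)))

blocks-word : ∀ a k → blocks (word (suc a) k) ≡ (suc a , k) ∷ []
blocks-word a k = trans (blocksGo-zeros 0 a (replicate k true)) (blocksGo-ones a 0 k)

qDecreasing-word⇔ : ∀ c d a k → qDecreasing c d (word (suc a) k) ⇔ d * k < c * suc a
qDecreasing-word⇔ c d a k = mk⇔ to (λ lt → subst (All (okBlock c d)) (sym (blocks-word a k)) (inj₂ lt ∷ []))
  where
  to : qDecreasing c d (word (suc a) k) → d * k < c * suc a
  to q with inj₂ lt ∷ [] ← subst (All (okBlock c d)) (blocks-word a k) q = lt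

-- The floor function ⌊m/q⌋

module Floor (c d : ℕ) {{_ : NonZero c}} where

  F : ℕ → ℕ
  F = floorDivQ c d

  -- c times the fractional part of m / q
  frac : ℕ → ℕ
  frac m = (m * d) % c

  frac<c : ∀ m → frac m < c
  frac<c m = m%n<n (m * d) c

  frac+F : ∀ m → m * d ≡ frac m + F m * c
  frac+F m = m≡m%n+[m/n]*n (m * d) c

  F-mono : ∀ {m n} → m ≤ n → F m ≤ F n
  F-mono m≤n = /-monoˡ-≤ c (*-monoˡ-≤ d m≤n)

  F<⇔ : ∀ k m → F k < m ⇔ d * k < c * m
  F<⇔ k m = mk⇔ to from
    where
    to : F k < m → d * k < c * m
    to Fk<m = begin-strict
      d * k              ≡⟨ *-comm d k ⟩
      k * d              ≡⟨ frac+F k ⟩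
      frac k + F k * c   <⟨ +-monoˡ-< (F k * c) (frac<c k) ⟩
      suc (F k) * c      ≤⟨ *-monoˡ-≤ c Fk<m ⟩
      m * c              ≡⟨ *-comm m c ⟩
      c * m              ∎
      where open ≤-Reasoning
    from : d * k < c * m → F k < m
    from lt = m<n*o⇒m/o<n (subst₂ _<_ (*-comm d k) (*-comm c m) lt)

  qDecreasing-word⇔F≤ : ∀ a k → qDecreasing c d (word (suc a) k) ⇔ F k ≤ a
  qDecreasing-word⇔F≤ a k = mk⇔
    (≤-pred ∘ Equivalence.from (F<⇔ k (suc a)) ∘ Equivalence.to (qDecreasing-word⇔ c d a k))
    (Equivalence.from (qDecreasing-word⇔ c d a k) ∘ Equivalence.to (F<⇔ k (suc a)) ∘ s≤s)

  shift-eq : ∀ m i → (m + i) * d ≡ (frac m + d * i) + F m * c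
  shift-eq m i = begin
    (m + i) * d                ≡⟨ *-distribʳ-+ d m i ⟩
    m * d + i * d              ≡⟨ cong₂ _+_ (frac+F m) (*-comm i d) ⟩
    frac m + F m * c + d * i   ≡⟨ +-assoc (frac m) (F m * c) (d * i) ⟩
    frac m + (F m * c + d * i) ≡⟨ cong (frac m +_) (+-comm (F m * c) (d * i)) ⟩
    frac m + (d * i + F m * c) ≡⟨ sym (+-assoc (frac m) (d * i) (F m * c)) ⟩
    frac m + d * i + F m * c   ∎
    where open ≡-Reasoning

  F-shift : ∀ m i → F (m + i) ≡ F m + (frac m + d * i) / c
  F-shift m i = begin
    F (m + i)                             ≡⟨ /-congˡ (shift-eq m i) ⟩
    (frac m + d * i + F m * c) / c        ≡⟨ +-distrib-/-∣ʳ (frac m + d * i) (divides (F m) refl) ⟩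
    (frac m + d * i) / c + F m * c / c    ≡⟨ cong ((frac m + d * i) / c +_) (m*n/n≡m (F m) c) ⟩
    (frac m + d * i) / c + F m            ≡⟨ +-comm _ (F m) ⟩
    F m + (frac m + d * i) / c            ∎
    where open ≡-Reasoning

  frac-shift : ∀ m i → frac (m + i) ≡ (frac m + d * i) % c
  frac-shift m i = trans (%-congˡ (shift-eq m i)) ([m+kn]%n≡m%n (frac m + d * i) (F m) c)

  periodic-eq : ∀ x k → (x + k * c) * d ≡ x * d + k * d * c
  periodic-eq x k = arith x k c d
    where
    arith : ∀ x k c d → (x + k * c) * d ≡ x * d + k * d * c
    arith = solve-∀

  F-periodic : ∀ x k → F (x + k * c) ≡ F x + k * d
  F-periodic x k = begin
    F (x + k * c)              ≡⟨ /-congˡ (periodic-eq x k) ⟩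
    (x * d + k * d * c) / c    ≡⟨ +-distrib-/-∣ʳ (x * d) (divides (k * d) refl) ⟩
    F x + k * d * c / c        ≡⟨ cong (F x +_) (m*n/n≡m (k * d) c) ⟩
    F x + k * d                ∎
    where open ≡-Reasoning

  frac-periodic : ∀ x k → frac (x + k * c) ≡ frac x
  frac-periodic x k = trans (%-congˡ (periodic-eq x k)) ([m+kn]%n≡m%n (x * d) (k * d) c)

  frac-suc-periodic⇔ : ∀ (P : ℕ → Set) x k → P (frac (suc (x + k * c))) ⇔ P (frac (suc x))
  frac-suc-periodic⇔ P x k = mk⇔ (subst P (frac-periodic (suc x) k)) (subst P (sym (frac-periodic (suc x) k)))

  F-flat⇔ : ∀ m i → F (m + i) ≤ F m ⇔ frac m + d * i < c
  F-flat⇔ m i = mk⇔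
    (λ le → m/n≡0⇒m<n (n≤0⇒n≡0 (+-cancelˡ-≤ (F m) _ 0 (subst₂ _≤_ (F-shift m i) (sym (+-identityʳ (F m))) le))))
    (λ lt → ≤-reflexive (trans (F-shift m i) (trans (cong (F m +_) (m<n⇒m/n≡0 lt)) (+-identityʳ (F m)))))

  F-suc-eq : ∀ b → F (suc b) ≡ F b + (frac b + d) / c
  F-suc-eq b = trans (cong F (+-comm 1 b)) (trans (F-shift b 1) (cong (λ t → F b + (frac b + t) / c) (*-identityʳ d)))

  frac-suc-eq : ∀ b → frac (suc b) ≡ (frac b + d) % c
  frac-suc-eq b = trans (cong frac (+-comm 1 b)) (trans (frac-shift b 1) (cong (λ t → (frac b + t) % c) (*-identityʳ d)))

  F-suc-cases : d < c → ∀ b → (F (suc b) ≡ F b × d ≤ frac (suc b)) ⊎ (F (suc b) ≡ suc (F b) × frac (suc b) < d)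
  F-suc-cases d<c b with frac b + d <? c
  ... | yes t<c = inj₁ (trans (F-suc-eq b) (trans (cong (F b +_) (m<n⇒m/n≡0 t<c)) (+-identityʳ (F b))) ,
                        subst (d ≤_) (sym (trans (frac-suc-eq b) (m<n⇒m%n≡m t<c))) (m≤n+m d (frac b)))
  ... | no t≮c = inj₂ (trans (F-suc-eq b) (trans (cong (F b +_) t/c≡1) (+-comm (F b) 1)) ,
                       subst (_< d) (sym (trans (frac-suc-eq b) t%c≡t∸c)) t∸c<d)
    where
    t = frac b + d
    c≤t : c ≤ t
    c≤t = ≮⇒≥ t≮c
    t∸c<d : t ∸ c < d
    t∸c<d = subst (t ∸ c <_) (m+n∸m≡n c d) (∸-monoˡ-< (+-monoˡ-< d (frac<c b)) c≤t)
    t/c≡1 : t / c ≡ 1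
    t/c≡1 = trans (m/n≡1+[m∸n]/n c≤t) (cong suc (m<n⇒m/n≡0 (<-trans t∸c<d d<c)))
    t%c≡t∸c : t % c ≡ t ∸ c
    t%c≡t∸c = trans (sym (m≤n⇒[n∸m]%m≡n%m c≤t)) (m<n⇒m%n≡m (<-trans t∸c<d d<c))

  F-suc≤ : d < c → ∀ b → F (suc b) ≤ suc (F b)
  F-suc≤ d<c b with F-suc-cases d<c b
  ... | inj₁ (flat , _) = m≤n⇒m≤1+n (≤-reflexive flat)
  ... | inj₂ (jump , _) = ≤-reflexive jump

  F-jump⇔ : d < c → ∀ b → F (suc b) ≡ suc (F b) ⇔ frac (suc b) < d
  F-jump⇔ d<c b with F-suc-cases d<c b
  ... | inj₁ (flat , d≤fr) = mk⇔ (λ jump → contradiction (trans (sym flat) jump) (<⇒≢ (n<1+n (F b)))) (λ fr<d → contradiction d≤fr (<⇒≱ fr<d))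
  ... | inj₂ (jump , fr<d) = mk⇔ (λ _ → fr<d) (λ _ → jump)

-- A, B, C and D as families indexed by b

module Characterisation (c d : ℕ) {{_ : NonZero c}} where
  open Floor c d

  inF-top : ∀ {b} → 1 ≤ b → inF c d (suc (F (suc b))) b
  inF-top {b} 1≤b = (s≤s z≤n , 1≤b) , s≤s (F-mono (n≤1+n b)) , ≤-refl

  inF-top-unique : ∀ {a b k} → inF c d (suc a) b → suc b ≤ k → F k ≤ a → a ≡ F (suc b)
  inF-top-unique (_ , _ , a≤F) sb≤k Fk≤a = ≤-antisym (≤-pred a≤F) (≤-trans (F-mono sb≤k) Fk≤a)

  inC⇔ : ∀ a b → inC c d a b ⇔ ((1 ≤ b × ⊤) × a ≡ suc (F (suc b)))
  inC⇔ a b = mk⇔ to λ { ((1≤b , _) , refl) → inF-top 1≤b , Equivalence.from (qDecreasing-word⇔F≤ _ _) ≤-refl }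
    where
    to : ∀ {a} → inC c d a b → (1 ≤ b × ⊤) × a ≡ suc (F (suc b))
    to {suc _} (f@((_ , 1≤b) , _) , q) = (1≤b , tt) , cong suc (inF-top-unique f ≤-refl (Equivalence.to (qDecreasing-word⇔F≤ _ _) q))

  inD⇔ : ∀ i a b → inD c d i a b ⇔ ((1 ≤ b × frac (suc b) + d * i < c) × a ≡ suc (F (suc b)))
  inD⇔ i a b = mk⇔ to from
    where
    k≡ : b + i + 1 ≡ suc b + i
    k≡ = +-comm (b + i) 1
    to : ∀ {a} → inD c d i a b → (1 ≤ b × frac (suc b) + d * i < c) × a ≡ suc (F (suc b))
    to {suc _} (f@((_ , 1≤b) , _) , q) = (1≤b , Equivalence.to (F-flat⇔ (suc b) i) flat) , cong suc a≡
      where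
      Fk≤a = Equivalence.to (qDecreasing-word⇔F≤ _ _) q
      a≡ = inF-top-unique f (subst (suc b ≤_) (sym k≡) (m≤m+n (suc b) i)) Fk≤a
      flat : F (suc b + i) ≤ F (suc b)
      flat = subst₂ _≤_ (cong F k≡) a≡ Fk≤a
    from : ∀ {a} → (1 ≤ b × frac (suc b) + d * i < c) × a ≡ suc (F (suc b)) → inD c d i a b
    from ((1≤b , no-carry) , refl) = inF-top 1≤b ,
      Equivalence.from (qDecreasing-word⇔F≤ _ _) (subst (λ k → F k ≤ F (suc b)) (sym k≡) (Equivalence.from (F-flat⇔ (suc b) i) no-carry))

  module _ (d<c : d < c) where

    inA⇔ : ∀ a b → inA c d a b ⇔ ((1 ≤ b × frac (suc b) < d) × a ≡ suc (F b))
    inA⇔ a b = mk⇔ to from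
      where
      to : ∀ {a} → inA c d a b → (1 ≤ b × frac (suc b) < d) × a ≡ suc (F b)
      to {suc a} (((_ , 1≤b) , Fb<a , _) , ¬q) = (1≤b , Equivalence.to (F-jump⇔ d<c b) jump) , cong suc a≡Fb
        where
        a<Fsb : a < F (suc b)
        a<Fsb = ≰⇒> (¬q ∘ Equivalence.from (qDecreasing-word⇔F≤ a (suc b)))
        a≡Fb : a ≡ F b
        a≡Fb = ≤-antisym (≤-pred (<-≤-trans a<Fsb (F-suc≤ d<c b))) (≤-pred Fb<a)
        jump : F (suc b) ≡ suc (F b)
        jump = ≤-antisym (F-suc≤ d<c b) (subst (λ x → suc x ≤ F (suc b)) a≡Fb a<Fsb)
      from : ∀ {a} → (1 ≤ b × frac (suc b) < d) × a ≡ suc (F b) → inA c d a b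
      from ((1≤b , fr<d) , refl) = ((s≤s z≤n , 1≤b) , ≤-refl , s≤s (F-mono (n≤1+n b))) , λ q →
        1+n≰n (subst (_≤ F b) (Equivalence.from (F-jump⇔ d<c b) fr<d) (Equivalence.to (qDecreasing-word⇔F≤ (F b) (suc b)) q))

    inB⇔ : ∀ a b → inB c d a b ⇔ ((1 ≤ b × frac (suc b) < d) × a ≡ suc (suc (F b)))
    inB⇔ a b = mk⇔ to from
      where
      to : ∀ {a} → inB c d a b → (1 ≤ b × frac (suc b) < d) × a ≡ suc (suc (F b))
      to {suc zero} (_ , s≤s () , _)
      to {suc (suc a)} (((_ , 1≤b) , _ , a<Fsb) , _ , q) = (1≤b , Equivalence.to (F-jump⇔ d<c b) jump) , cong (suc ∘ suc) a≡Fb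
        where
        a≡Fb : a ≡ F b
        a≡Fb = ≤-antisym (≤-pred (≤-trans (≤-pred a<Fsb) (F-suc≤ d<c b))) (Equivalence.to (qDecreasing-word⇔F≤ a b) q)
        jump : F (suc b) ≡ suc (F b)
        jump = ≤-antisym (F-suc≤ d<c b) (subst (λ x → suc x ≤ F (suc b)) a≡Fb (≤-pred a<Fsb))
      from : ∀ {a} → (1 ≤ b × frac (suc b) < d) × a ≡ suc (suc (F b)) → inB c d a b
      from ((1≤b , fr<d) , refl) =
        ((s≤s z≤n , 1≤b) , n≤1+n _ , s≤s (≤-reflexive (sym (Equivalence.from (F-jump⇔ d<c b) fr<d)))) ,
        s≤s (s≤s z≤n) , Equivalence.from (qDecreasing-word⇔F≤ (F b) b) ≤-refl

module Modular (c : ℕ) .{{_ : NonZero c}} where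

  %-cong-+ : ∀ {x x′ y y′} → x % c ≡ x′ % c → y % c ≡ y′ % c → (x + y) % c ≡ (x′ + y′) % c
  %-cong-+ {x} {x′} {y} {y′} x≡ y≡ =
    trans (%-distribˡ-+ x y c) (trans (cong₂ (λ u v → (u + v) % c) x≡ y≡) (sym (%-distribˡ-+ x′ y′ c)))

  %-cong-* : ∀ {x x′ y y′} → x % c ≡ x′ % c → y % c ≡ y′ % c → (x * y) % c ≡ (x′ * y′) % c
  %-cong-* {x} {x′} {y} {y′} x≡ y≡ =
    trans (%-distribˡ-* x y c) (trans (cong₂ (λ u v → (u * v) % c) x≡ y≡) (sym (%-distribˡ-* x′ y′ c)))

  -- adding k * (c - 1) turns k + x into x + k * c
  %-cancelˡ-+ : ∀ k {x y} → (k + x) % c ≡ (k + y) % c → x % c ≡ y % c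
  %-cancelˡ-+ k {x} {y} eq = trans (sym (undo x)) (trans (%-cong-+ {k * pred c} refl eq) (undo y))
    where
    undo : ∀ x → (k * pred c + (k + x)) % c ≡ x % c
    undo x = trans (cong (_% c) (trans (arith k (pred c) x) (cong (λ t → x + k * t) (suc-pred c)))) ([m+kn]%n≡m%n x k c)
      where
      arith : ∀ k c′ x → k * c′ + (k + x) ≡ x + k * suc c′
      arith = solve-∀

module ModularInverse (c d dinv : ℕ) {{_ : NonZero c}} (d*dinv≡1 : (d * dinv) % c ≡ 1 % c) where
  open Floor c d
  open Modular c

  %-unit : ∀ x → (x * (d * dinv)) % c ≡ x % c
  %-unit x = trans (%-cong-* {x} refl d*dinv≡1) (cong (_% c) (*-identityʳ x))

  frac-inv : ∀ {x y} → x % c ≡ (dinv * y) % c → frac x ≡ y % c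
  frac-inv {x} {y} eq = begin
    (x * d) % c          ≡⟨ %-cong-* eq refl ⟩
    (dinv * y * d) % c   ≡⟨ cong (_% c) (arith dinv y d) ⟩
    (y * (d * dinv)) % c ≡⟨ %-unit y ⟩
    y % c                ∎
    where
    open ≡-Reasoning
    arith : ∀ dinv y d → dinv * y * d ≡ y * (d * dinv)
    arith = solve-∀

  %-from-frac : ∀ x → x % c ≡ (frac x * dinv) % c
  %-from-frac x = begin
    x % c                    ≡⟨ sym (%-unit x) ⟩
    (x * (d * dinv)) % c     ≡⟨ cong (_% c) (sym (*-assoc x d dinv)) ⟩
    (x * d * dinv) % c       ≡⟨ %-cong-* (sym (m%n%n≡m%n (x * d) c)) refl ⟩
    (frac x * dinv) % c      ∎
    where open ≡-Reasoning

  frac-suc-injective : ∀ {x y} → InWindow c x → InWindow c y → frac (suc x) ≡ frac (suc y) → x ≡ y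
  frac-suc-injective {suc u} {suc u′} (_ , u<c) (_ , u′<c) eq = cong suc (begin
    u      ≡⟨ sym (m<n⇒m%n≡m u<c) ⟩
    u % c  ≡⟨ %-cancelˡ-+ 2 (trans (%-from-frac (2 + u)) (trans (cong (λ r → (r * dinv) % c) eq) (sym (%-from-frac (2 + u′))))) ⟩
    u′ % c ≡⟨ m<n⇒m%n≡m u′<c ⟩
    u′     ∎)
    where open ≡-Reasoning

  enumerates-by-frac : ∀ n (f : ℕ → ℕ) (P : ℕ → Set) → (∀ r → P r ⇔ r < n) →
    (∀ j → j < n → InWindow c (f j) × frac (suc (f j)) ≡ j) →
    EnumeratesWindow c (P ∘ frac ∘ suc) (map f (upTo n))
  enumerates-by-frac n f P P⇔ hf = record { unique = unique ; sound = sound ; complete = complete }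
    where
    unique : Unique (map f (upTo n))
    unique = subst Unique (sym (map-upTo f n)) (applyUpTo⁺₁ f n λ {i} {j} i<j j<n fi≡fj →
      <⇒≢ i<j (trans (sym (proj₂ (hf i (<-trans i<j j<n)))) (trans (cong (frac ∘ suc) fi≡fj) (proj₂ (hf j j<n)))))
    sound : ∀ {x} → x ∈ map f (upTo n) → InWindow c x × P (frac (suc x))
    sound x∈ with j , j∈ , refl ← ∈-map⁻ f x∈ with bounds , frac≡j ← hf j (∈-upTo⁻ j∈) =
      bounds , Equivalence.from (P⇔ _) (subst (_< n) (sym frac≡j) (∈-upTo⁻ j∈))
    complete : ∀ {x} → InWindow c x → P (frac (suc x)) → x ∈ map f (upTo n)
    complete {x} x∈W Px with fj∈W , frac≡j ← hf (frac (suc x)) (Equivalence.to (P⇔ _) Px) =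
      subst (_∈ map f (upTo n)) (frac-suc-injective fj∈W x∈W frac≡j)
            (∈-map⁺ f (∈-upTo⁺ (Equivalence.to (P⇔ _) Px)))

m+n<o⇔m<o∸n : ∀ m n o → m + n < o ⇔ m < o ∸ n
m+n<o⇔m<o∸n m n o = mk⇔ (m+n≤o⇒m≤o∸n (suc m)) from
  where
  from : m < o ∸ n → m + n < o
  from m<o∸n = m≤o∸n⇒m+n≤o (suc m) (<⇒≤ (m∸n≢0⇒n<m (<⇒≢ (≤-<-trans z≤n m<o∸n) ∘ sym))) m<o∸n

ceilDiv-bound : ∀ {c d i} {{_ : NonZero d}} → 1 ≤ i → i ≤ ceilDiv c d ∸ 1 → d * i < c
ceilDiv-bound {c} {d} {i} 1≤i i≤q∸1 = +-cancelʳ-< d (d * i) c (begin-strict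
  d * i + d      ≡⟨ arith d i ⟩
  (i + 1) * d    ≤⟨ *-monoˡ-≤ d (m≤o∸n⇒m+n≤o i (≤-trans 1≤i (≤-trans i≤q∸1 (m∸n≤m (ceilDiv c d) 1))) i≤q∸1) ⟩
  ceilDiv c d * d ≤⟨ m/n*n≤m (c + d ∸ 1) d ⟩
  c + d ∸ 1      <⟨ ∸-monoʳ-< z<s (≤-trans (>-nonZero⁻¹ d) (m≤n+m d c)) ⟩
  c + d          ∎)
  where
  open ≤-Reasoning
  arith : ∀ d i → d * i + d ≡ (i + 1) * d
  arith = solve-∀

-- The generating functions

module GeneratingFunctions (c d dinv : ℕ) {{_ : NonZero c}} (d<c : d < c) (d*dinv≡1 : (d * dinv) % c ≡ 1 % c) where
  open Floor c d
  open Modular c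
  open Characterisation c d
  open ModularInverse c d dinv d*dinv≡1

  frac-suc-a : ∀ {x j} → j < d → x % c ≡ (dinv * (c ∸ d ∸ 1 + suc j)) % c → frac (suc x) ≡ j
  frac-suc-a {x} {j} j<d x≡ = begin
    frac (suc x)                  ≡⟨ frac-inv suc-x≡ ⟩
    (d + K) % c                   ≡⟨ cong (_% c) d+K≡ ⟩
    (j + 1 * c) % c               ≡⟨ [m+kn]%n≡m%n j 1 c ⟩
    j % c                         ≡⟨ m<n⇒m%n≡m (<-trans j<d d<c) ⟩
    j                             ∎
    where
    open ≡-Reasoning
    K = c ∸ d ∸ 1 + suc j
    suc-x≡ : suc x % c ≡ (dinv * (d + K)) % c
    suc-x≡ = trans (%-cong-+ (sym d*dinv≡1) x≡)
      (cong (_% c) (trans (cong (_+ dinv * K) (*-comm d dinv)) (sym (*-distribˡ-+ dinv d K))))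
    c≡ : c ∸ d ∸ 1 + suc d ≡ c
    c≡ = begin
      c ∸ d ∸ 1 + suc d   ≡⟨ +-suc (c ∸ d ∸ 1) d ⟩
      suc (c ∸ d ∸ 1) + d ≡⟨ cong (_+ d) (trans (+-comm 1 (c ∸ d ∸ 1)) (m∸n+n≡m (m<n⇒0<n∸m d<c))) ⟩
      c ∸ d + d           ≡⟨ m∸n+n≡m (<⇒≤ d<c) ⟩
      c                   ∎
    d+K≡ : d + K ≡ j + 1 * c
    d+K≡ = trans (arith d (c ∸ d ∸ 1) j) (cong (λ t → j + (t + 0)) c≡)
      where
      arith : ∀ d e j → d + (e + suc j) ≡ j + ((e + suc d) + 0)
      arith = solve-∀

  frac-suc-b : ∀ {x m} → m < c → (x + 1) % c ≡ (dinv * m) % c → frac (suc x) ≡ m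
  frac-suc-b {x} m<c x≡ = trans (frac-inv (trans (cong (_% c) (+-comm 1 x)) x≡)) (m<n⇒m%n≡m m<c)

  module _ (a : ℕ → ℕ)
    (ha : ∀ i → 1 ≤ i → i ≤ d → 1 ≤ a i × a i ≤ c × a i % c ≡ (dinv * (c ∸ d ∸ 1 + i)) % c) where

    enumerates-a : EnumeratesWindow c (λ x → frac (suc x) < d) (map (a ∘ suc) (upTo d))
    enumerates-a = enumerates-by-frac d (a ∘ suc) (_< d) (λ _ → mk⇔ id id) λ j j<d →
      let 1≤a , a≤c , a≡ = ha (suc j) (s≤s z≤n) j<d in (1≤a , a≤c) , frac-suc-a j<d a≡

    genFun-A : ∀ n → genFun (inA? c d) n ≡ (poly (map (λ i → 1 + a i + F (a i)) (map suc (upTo d))) ⊛ geom (c + d)) n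
    genFun-A n = trans
      (PeriodicFamily.genFun≡poly⊛geom (inA? c d) c d _ (suc ∘ F) (inA⇔ d<c) (s≤s ∘ F-mono)
        (λ x k → cong suc (F-periodic x k)) (frac-suc-periodic⇔ (_< d)) enumerates-a n)
      (cong (λ es → (poly es ⊛ geom (c + d)) n)
        (trans (map-fuse (λ j → +-suc (a (suc j)) _) (upTo d)) (sym (map-fuse (λ _ → refl) (upTo d)))))

    genFun-B : ∀ n → genFun (inB? c d) n ≡ (poly (map (λ i → 2 + a i + F (a i)) (map suc (upTo d))) ⊛ geom (c + d)) n
    genFun-B n = trans
      (PeriodicFamily.genFun≡poly⊛geom (inB? c d) c d _ (suc ∘ suc ∘ F) (inB⇔ d<c) (s≤s ∘ s≤s ∘ F-mono)
        (λ x k → cong (suc ∘ suc) (F-periodic x k)) (frac-suc-periodic⇔ (_< d)) enumerates-a n)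
      (cong (λ es → (poly es ⊛ geom (c + d)) n)
        (trans (map-fuse (λ j → trans (+-suc (a (suc j)) _) (cong suc (+-suc (a (suc j)) _))) (upTo d))
               (sym (map-fuse (λ _ → refl) (upTo d)))))

  genFun-C : ∀ n → genFun (inC? c d) n ≡ (poly (map (λ i → i + F i) (map (2 +_) (upTo c))) ⊛ geom (c + d)) n
  genFun-C n = trans
    (PeriodicFamily.genFun≡poly⊛geom (inC? c d) c d _ (suc ∘ F ∘ suc) inC⇔ (s≤s ∘ F-mono ∘ s≤s)
      (λ x k → cong suc (F-periodic (suc x) k)) (λ _ _ → mk⇔ id id) (upTo-window c) n)
    (cong (λ es → (poly es ⊛ geom (c + d)) n)
      (trans (map-fuse (λ j → +-suc (suc j) _) (upTo c)) (sym (map-fuse (λ _ → refl) (upTo c)))))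

  module _ (b : ℕ → ℕ)
    (hb : ∀ m → m ≤ c ∸ d ∸ 1 → 1 ≤ b m × b m ≤ c × (b m + 1) % c ≡ (dinv * m) % c) where

    module _ {i : ℕ} (1≤i : 1 ≤ i) (di<c : d * i < c) where

      K = c ∸ 1 ∸ d * i

      below⇔ : ∀ r → r + d * i < c ⇔ r < suc K
      below⇔ r = subst (λ t → r + d * i < c ⇔ r < t) c∸di≡ (m+n<o⇔m<o∸n r (d * i) c)
        where
        c∸di≡ : c ∸ d * i ≡ suc K
        c∸di≡ = trans (+-∸-assoc 1 {c} {suc (d * i)} di<c) (cong suc (sym (∸-+-assoc c 1 (d * i))))

      K≤ : K ≤ c ∸ d ∸ 1
      K≤ = subst₂ _≤_ (sym (∸-+-assoc c 1 (d * i))) (sym (trans (∸-+-assoc c d 1) (cong (c ∸_) (+-comm d 1))))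
        (∸-monoʳ-≤ c (s≤s (subst (_≤ d * i) (*-identityʳ d) (*-monoʳ-≤ d 1≤i))))

      enumerates-b : EnumeratesWindow c (λ x → frac (suc x) + d * i < c) (map b (upTo (suc K)))
      enumerates-b = enumerates-by-frac (suc K) b (λ r → r + d * i < c) below⇔ λ m m≤K →
        let 1≤b , b≤c , b≡ = hb m (≤-trans (≤-pred m≤K) K≤)
            m<c = ≤-<-trans (m≤m+n m (d * i)) (Equivalence.from (below⇔ m) m≤K)
        in (1≤b , b≤c) , frac-suc-b m<c b≡

      genFun-D : ∀ n → genFun (inD? c d i) n
        ≡ (poly (map (λ m → 1 + b m + F (b m + 1)) (upTo (suc (c ∸ 1 ∸ d * i)))) ⊛ geom (c + d)) n
      genFun-D n = trans
        (PeriodicFamily.genFun≡poly⊛geom (inD? c d i) c d _ (suc ∘ F ∘ suc) (inD⇔ i) (s≤s ∘ F-mono ∘ s≤s)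
          (λ x k → cong suc (F-periodic (suc x) k)) (frac-suc-periodic⇔ (λ r → r + d * i < c)) enumerates-b n)
        (cong (λ es → (poly es ⊛ geom (c + d)) n)
          (map-fuse {h = λ x → x + suc (F (suc x))} {f = b} (λ m → trans (+-suc (b m) _) (cong (λ t → suc (b m + F t)) (+-comm 1 (b m)))) (upTo (suc K))))

mainTheorem13 : (c d : ℕ) → {{_ : NonZero c}} → {{_ : NonZero d}} →
    Coprime c d → d < c →
    (dinv : ℕ) → (d * dinv) % c ≡ 1 % c →
    (a : ℕ → ℕ) →
    (∀ i → 1 ≤ i → i ≤ d →
      1 ≤ a i × a i ≤ c × a i % c ≡ (dinv * (c ∸ d ∸ 1 + i)) % c) →
    (b : ℕ → ℕ) →
    (∀ m → m ≤ c ∸ d ∸ 1 →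
      1 ≤ b m × b m ≤ c × (b m + 1) % c ≡ (dinv * m) % c) →
    (∀ n → genFun (inA? c d) n
      ≡ (poly (map (λ i → 1 + a i + floorDivQ c d (a i)) (map suc (upTo d))) ⊛ geom (c + d)) n)
    × (∀ n → genFun (inB? c d) n
      ≡ (poly (map (λ i → 2 + a i + floorDivQ c d (a i)) (map suc (upTo d))) ⊛ geom (c + d)) n)
    × (∀ n → genFun (inC? c d) n
      ≡ (poly (map (λ i → i + floorDivQ c d i) (map (2 +_) (upTo c))) ⊛ geom (c + d)) n)
    × (∀ i → 1 ≤ i → i ≤ ceilDiv c d ∸ 1 → ∀ n → genFun (inD? c d i) n
      ≡ (poly (map (λ m → 1 + b m + floorDivQ c d (b m + 1)) (upTo (suc (c ∸ 1 ∸ d * i)))) ⊛ geom (c + d)) n)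
mainTheorem13 c d _ d<c dinv d*dinv≡1 a ha b hb =
  genFun-A a ha , genFun-B a ha , genFun-C , λ i 1≤i i≤ → genFun-D b hb 1≤i (ceilDiv-bound 1≤i i≤)
  where open GeneratingFunctions c d dinv d<c d*dinv≡1
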